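{- Let $U$ be the $\gamma$-unitization of the GPEA $P$ and let $\sim$ be a congruence on $P$. Then $\sim^*$ is a congruence on $U$ iff $\sim$ is a $\gamma$-congruence that satisfies (C4) and (C5$'$).
   Context: $P$ is a GPEA (partial $\oplus$, constant $0$; partial associativity; conjugation; two-sided cancellation; neutral $0$; positivity), ordered by $a\le b$ iff $a\oplus c=b$ for some $c$; for $a\le b$, $a/b$ is the unique $c$ with $a\oplus c=b$ and $b\backslash a$ the unique $d$ with $d\oplus a=b$. $\gamma$ is a unitizing GPEA-automorphism ($\gamma a\oplus b$ defined iff $b\oplus a$ defined). The $\gamma$-unitization $U=P\cup P^\eta$ ($\eta$ a bijection of $P$ onto a disjoint set $P^\eta$, $1:=\eta0$): sums in $P$ as in $P$; $a+\eta b$ defined iff $a\le b$, equal to $\eta(b\backslash a)$; $\eta a+b$ defined iff $\gamma b\le a$, equal to $\eta(\gamma b/a)$; no sums within $P^\eta$. $U$ is a pseudo effect algebra with $\eta a=a^\sim$, $\gamma a=a^{ -- }$. A relation $\sim$ is a congruence iff (C1) it is an equivalence, (C2) $a\oplus b$, $a_1\oplus b_1$ exist, $a\sim a_1$, $b\sim b_1$ imply $a\oplus b\sim a_1\oplus b_1$, (C3) if $a\oplus b$ exists, for any $a_1\sim a$ there is $b_1\sim b$ with $a_1\oplus b_1$ existing, and for any $b_2\sim b$ there is $a_2\sim a$ with $a_2\oplus b_2$ existing. (C4): if $a\sim b$ and either $a\oplus a_1\sim b\oplus b_1$ or $a_1\oplus a\sim b_1\oplus b$, then $a_1\sim b_1$.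 (C5$'$): $a\sim b\oplus c$ implies $a=a_1\oplus a_2$ with $a_1\sim b$, $a_2\sim c$. $\sim$ is a $\gamma$-congruence iff $a\sim b\Leftrightarrow\gamma a\sim\gamma b$. $\sim^*$ on $U$: $a\sim^*b$ iff $a\sim b$, $\eta a\sim^*\eta b$ iff $a\sim b$ ($a,b\in P$), and no element of $P$ is related to an element of $P^\eta$. -}

module Defs where

open import Data.Product using (Σ; ∃; _×_; _,_)
open import Data.Sum using (_⊎_; inj₁; inj₂)
open import Data.Empty using (⊥)
open import Relation.Binary.PropositionalEquality using (_≡_)
open import Relation.Binary.Core using (Rel)
open import Relation.Binary.Structures using (IsEquivalence)
open import Function.Bundles using (_⇔_)
open import Level using (0ℓ)

-- A partial binary operation is represented by its graph:
-- Sum a b c  means  "a ⊕ b is defined and equals c".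

Defined : {C : Set} → (C → C → C → Set) → C → C → Set
Defined {C} S a b = ∃ λ c → S a b c

record GPEA : Set₁ where
  field
    Carrier : Set
    Sum     : Carrier → Carrier → Carrier → Set
    𝟘       : Carrier
    functional : ∀ {a b c c'} → Sum a b c → Sum a b c' → c ≡ c'
    assocˡ : ∀ {a b c ab abc} → Sum a b ab → Sum ab c abc →
             ∃ λ bc → Sum b c bc × Sum a bc abc
    assocʳ : ∀ {a b c bc abc} → Sum b c bc → Sum a bc abc →
             ∃ λ ab → Sum a b ab × Sum ab c abc
    conjugation : ∀ {a b c} → Sum a b c →
                  (∃ λ d → Sum d a c) × (∃ λ e → Sum b e c)
    cancelˡ : ∀ {a b c x} → Sum a b x → Sum a c x → b ≡ c
    cancelʳ : ∀ {a b c x} → Sum b a x → Sum c a x → b ≡ c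
    neutralʳ : ∀ a → Sum a 𝟘 a
    neutralˡ : ∀ a → Sum 𝟘 a a
    positive : ∀ {a b} → Sum a b 𝟘 → (a ≡ 𝟘) × (b ≡ 𝟘)

  _≤_ : Carrier → Carrier → Set
  a ≤ b = ∃ λ c → Sum a c b

record UnitizingAut (P : GPEA) : Set where
  open GPEA P
  field
    γ    : Carrier → Carrier
    γ⁻¹  : Carrier → Carrier
    γ-γ⁻¹ : ∀ a → γ (γ⁻¹ a) ≡ a
    γ⁻¹-γ : ∀ a → γ⁻¹ (γ a) ≡ a
    γ-hom  : ∀ {a b c} → Sum a b c → Sum (γ a) (γ b) (γ c)
    γ-homᶜ : ∀ {a b c} → Sum (γ a) (γ b) (γ c) → Sum a b c
    unitizing : ∀ a b → Defined Sum (γ a) b ⇔ Defined Sum b a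

-- The γ-unitization U = P ∪ P^η; inj₁ a is a ∈ P, inj₂ a is η a.
module Unitization (P : GPEA) (G : UnitizingAut P) where
  open GPEA P
  open UnitizingAut G

  UCarrier : Set
  UCarrier = Carrier ⊎ Carrier

  η : Carrier → UCarrier
  η = inj₂

  𝟙 : UCarrier
  𝟙 = η 𝟘

  USum : UCarrier → UCarrier → UCarrier → Set
  USum (inj₁ a) (inj₁ b) (inj₁ c) = Sum a b c
  -- a + ηb defined iff a ≤ b, equal to η(b\a), where (b\a) ⊕ a = b
  USum (inj₁ a) (inj₂ b) (inj₂ d) = (a ≤ b) × Sum d a b
  -- ηa + b defined iff γb ≤ a, equal to η(γb/a), where γb ⊕ (γb/a) = a
  USum (inj₂ a) (inj₁ b) (inj₂ c) = (γ b ≤ a) × Sum (γ b) c a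
  USum _ _ _ = ⊥

  ext : Rel Carrier 0ℓ → Rel UCarrier 0ℓ
  ext _∼_ (inj₁ a) (inj₁ b) = a ∼ b
  ext _∼_ (inj₂ a) (inj₂ b) = a ∼ b
  ext _∼_ _ _ = ⊥

record IsCongruence {C : Set} (S : C → C → C → Set) (_∼_ : Rel C 0ℓ) : Set where
  field
    isEquivalence : IsEquivalence _∼_
    compat : ∀ {a b c a₁ b₁ c₁} → S a b c → S a₁ b₁ c₁ →
             a ∼ a₁ → b ∼ b₁ → c ∼ c₁
    liftʳ : ∀ {a b} → Defined S a b →
            ∀ a₁ → a₁ ∼ a → ∃ λ b₁ → b₁ ∼ b × Defined S a₁ b₁
    liftˡ : ∀ {a b} → Defined S a b →
            ∀ b₂ → b₂ ∼ b → ∃ λ a₂ → a₂ ∼ a × Defined S a₂ b₂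

C4 : {C : Set} (S : C → C → C → Set) (_∼_ : Rel C 0ℓ) → Set
C4 S _∼_ =
  (∀ {a b a₁ b₁ x y} → a ∼ b → S a a₁ x → S b b₁ y → x ∼ y → a₁ ∼ b₁) ×
  (∀ {a b a₁ b₁ x y} → a ∼ b → S a₁ a x → S b₁ b y → x ∼ y → a₁ ∼ b₁)

C5′ : {C : Set} (S : C → C → C → Set) (_∼_ : Rel C 0ℓ) → Set
C5′ S _∼_ = ∀ {a b c bc} → S b c bc → a ∼ bc →
            ∃ λ a₁ → ∃ λ a₂ → S a₁ a₂ a × a₁ ∼ b × a₂ ∼ c

IsγCongruence : {C : Set} (γ : C → C) (_∼_ : Rel C 0ℓ) → Set
IsγCongruence γ _∼_ = ∀ a b → (a ∼ b) ⇔ (γ a ∼ γ b)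

module Submission where

-- Sufficiency: (C2) for mixed U-sums is exactly (C4) (one side after applying γ),
-- and (C3) for mixed sums is obtained from (C3) on P or from (C5′).
-- Necessity: the U-sums ηγa + a = 1 give that γ and γ⁻¹ preserve ∼ (via the lifting
-- property (C3) of U and cancellation of summands ∼ 0); (C2) of U on mixed sums gives
-- (C4); lifting a decomposition ηa + γ⁻¹b = ηc gives (C5′).

open import Defs
open import Data.Product using (_×_; _,_; proj₁; proj₂; ∃; ∃₂)
open import Data.Sum using (inj₁; inj₂)
open import Relation.Binary.Core using (Rel)
open import Relation.Binary.Structures using (IsEquivalence)
open import Relation.Binary.PropositionalEquality
  using (_≡_; subst; subst₂; cong; sym; module ≡-Reasoning)
open import Function.Bundles using (_⇔_; mk⇔; Equivalence)
open import Level using (0ℓ)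

module UnitizationFacts (P : GPEA) (G : UnitizingAut P) where
  open GPEA P
  open UnitizingAut G
  open Unitization P G

  -- An automorphism fixes 0: γ0 ⊕ 0 = γ0 = γ0 ⊕ γ0, so γ0 = 0 by cancellation.
  γ-𝟘 : γ 𝟘 ≡ 𝟘
  γ-𝟘 = cancelˡ (γ-hom (neutralʳ 𝟘)) (neutralʳ (γ 𝟘))

  γ-below-𝟘 : ∀ {b c} → Sum (γ b) c 𝟘 → b ≡ 𝟘
  γ-below-𝟘 {b} s = begin
    b            ≡⟨ sym (γ⁻¹-γ b) ⟩
    γ⁻¹ (γ b)    ≡⟨ cong γ⁻¹ (proj₁ (positive s)) ⟩
    γ⁻¹ 𝟘        ≡⟨ cong γ⁻¹ (sym γ-𝟘) ⟩
    γ⁻¹ (γ 𝟘)    ≡⟨ γ⁻¹-γ 𝟘 ⟩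
    𝟘            ∎
    where open ≡-Reasoning

  γγ⁻¹-sum : ∀ {a b c} → Sum b c a → Sum (γ (γ⁻¹ b)) c a
  γγ⁻¹-sum {a} {b} {c} = subst (λ t → Sum t c a) (sym (γ-γ⁻¹ b))

  γ⁻¹-sum : ∀ {y c b} → Sum (γ y) c (γ b) → Sum y (γ⁻¹ c) b
  γ⁻¹-sum {y} {c} {b} s = γ-homᶜ (subst (λ t → Sum (γ y) t (γ b)) (sym (γ-γ⁻¹ c)) s)

  ηsumˡ : ∀ {a b c} → Sum (γ b) c a → USum (η a) (inj₁ b) (η c)
  ηsumˡ {c = c} s = (c , s) , s

  ηsumʳ : ∀ {a b d} → Sum d a b → USum (inj₁ a) (η b) (η d)
  ηsumʳ s = proj₂ (conjugation s) , s

  γ⁻¹-preserves : {R : Rel Carrier 0ℓ} → (∀ {a b} → R (γ a) (γ b) → R a b) →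
                  ∀ {a b} → R a b → R (γ⁻¹ a) (γ⁻¹ b)
  γ⁻¹-preserves {R} reflects {a} {b} r =
    reflects (subst₂ R (sym (γ-γ⁻¹ a)) (sym (γ-γ⁻¹ b)) r)

  ext-isEquivalence : {_∼_ : Rel Carrier 0ℓ} → IsEquivalence _∼_ → IsEquivalence (ext _∼_)
  ext-isEquivalence {_∼_} E = record { refl = λ {x} → refl* {x}
                                     ; sym = λ {x} {y} → sym* {x} {y}
                                     ; trans = λ {x} {y} {z} → trans* {x} {y} {z} }
    where
    module E = IsEquivalence E
    refl* : ∀ {x} → ext _∼_ x x
    refl* {inj₁ _} = E.refl
    refl* {inj₂ _} = E.refl
    sym* : ∀ {x y} → ext _∼_ x y → ext _∼_ y x
    sym* {inj₁ _} {inj₁ _} = E.sym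
    sym* {inj₂ _} {inj₂ _} = E.sym
    trans* : ∀ {x y z} → ext _∼_ x y → ext _∼_ y z → ext _∼_ x z
    trans* {inj₁ _} {inj₁ _} {inj₁ _} = E.trans
    trans* {inj₂ _} {inj₂ _} {inj₂ _} = E.trans

-- A congruence on a GPEA identifies b ⊕ c with b when c ∼ 0 (by (C2) against b ⊕ 0 = b).
∼𝟘-summand : (P : GPEA) {_∼_ : Rel (GPEA.Carrier P) 0ℓ} → IsCongruence (GPEA.Sum P) _∼_ →
             ∀ {b c x} → GPEA.Sum P b c x → c ∼ GPEA.𝟘 P → b ∼ x
∼𝟘-summand P CP s c∼𝟘 =
  C.compat (GPEA.neutralʳ P _) s E.refl (E.sym c∼𝟘)
  where
  module C = IsCongruence CP
  module E = IsEquivalence C.isEquivalence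

module _ (P : GPEA) (G : UnitizingAut P) (_∼_ : Rel (GPEA.Carrier P) 0ℓ)
         (CP : IsCongruence (GPEA.Sum P) _∼_) where
  open GPEA P
  open UnitizingAut G
  open Unitization P G
  open UnitizationFacts P G
  module C = IsCongruence CP
  module E = IsEquivalence C.isEquivalence

  module Sufficiency (γ-cong : IsγCongruence γ _∼_) (c4 : C4 Sum _∼_) (c5 : C5′ Sum _∼_) where
    γ-preserves : ∀ {a b} → a ∼ b → γ a ∼ γ b
    γ-preserves {a} {b} = Equivalence.to (γ-cong a b)

    γ-reflects : ∀ {a b} → γ a ∼ γ b → a ∼ b
    γ-reflects {a} {b} = Equivalence.from (γ-cong a b)

    -- (C2) on U: on mixed sums the results are differences, matched by (C4).
    compat* : ∀ {a b c a₁ b₁ c₁} → USum a b c → USum a₁ b₁ c₁ →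
              ext _∼_ a a₁ → ext _∼_ b b₁ → ext _∼_ c c₁
    compat* {inj₁ _} {inj₁ _} {inj₁ _} {inj₁ _} {inj₁ _} {inj₁ _} s s₁ p q = C.compat s s₁ p q
    compat* {inj₁ _} {inj₂ _} {inj₂ _} {inj₁ _} {inj₂ _} {inj₂ _} (_ , s) (_ , s₁) p q =
      proj₂ c4 p s s₁ q
    compat* {inj₂ _} {inj₁ _} {inj₂ _} {inj₂ _} {inj₁ _} {inj₂ _} (_ , s) (_ , s₁) p q =
      proj₁ c4 (γ-preserves q) s s₁ p

    liftʳ* : ∀ {a b} → Defined USum a b →
             ∀ a₁ → ext _∼_ a₁ a → ∃ λ b₁ → ext _∼_ b₁ b × Defined USum a₁ b₁
    liftʳ* {inj₁ _} {inj₁ _} (inj₁ c , s) (inj₁ a₁) p with C.liftʳ (c , s) a₁ p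
    ... | b₁ , q , (c₁ , s₁) = inj₁ b₁ , q , (inj₁ c₁ , s₁)
    -- a + ηb = ηd: lift d ⊕ a = b to d₁ ⊕ a₁ = b₁ in P.
    liftʳ* {inj₁ _} {inj₂ b} (inj₂ _ , (_ , s)) (inj₁ a₁) p with C.liftˡ (b , s) a₁ p
    ... | d₁ , q , (b₁ , s₁) = inj₂ b₁ , C.compat s₁ s q p , (inj₂ d₁ , ηsumʳ s₁)
    -- ηa + b = ηc: split a₁ ∼ γb ⊕ c by (C5′) as u ⊕ v, then ηa₁ + γ⁻¹u = ηv.
    liftʳ* {inj₂ _} {inj₁ b} (inj₂ _ , (_ , s)) (inj₂ a₁) p with c5 s p
    ... | u , v , s₁ , u∼γb , _ =
      inj₁ (γ⁻¹ u) , subst (γ⁻¹ u ∼_) (γ⁻¹-γ b) (γ⁻¹-preserves (λ {x} {y} → γ-reflects {x} {y}) u∼γb) ,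
      (inj₂ v , ηsumˡ (γγ⁻¹-sum s₁))

    liftˡ* : ∀ {a b} → Defined USum a b →
             ∀ b₂ → ext _∼_ b₂ b → ∃ λ a₂ → ext _∼_ a₂ a × Defined USum a₂ b₂
    liftˡ* {inj₁ _} {inj₁ _} (inj₁ c , s) (inj₁ b₂) p with C.liftˡ (c , s) b₂ p
    ... | a₂ , q , (c₂ , s₂) = inj₁ a₂ , q , (inj₁ c₂ , s₂)
    -- a + ηb = ηd: split b₂ ∼ d ⊕ a by (C5′) as u ⊕ v, then v + ηb₂ = ηu.
    liftˡ* {inj₁ _} {inj₂ _} (inj₂ _ , (_ , s)) (inj₂ b₂) p with c5 s p
    ... | u , v , s₂ , _ , v∼a = inj₁ v , v∼a , (inj₂ u , ηsumʳ s₂)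
    -- ηa + b = ηc: lift γb ⊕ c = a to γb₂ ⊕ c₂ = a₂ in P.
    liftˡ* {inj₂ a} {inj₁ _} (inj₂ _ , (_ , s)) (inj₁ b₂) p with C.liftʳ (a , s) (γ b₂) (γ-preserves p)
    ... | c₂ , q , (a₂ , s₂) = inj₂ a₂ , C.compat s₂ s (γ-preserves p) q , (inj₂ c₂ , ηsumˡ s₂)

    isCongruence* : IsCongruence USum (ext _∼_)
    isCongruence* = record
      { isEquivalence = ext-isEquivalence C.isEquivalence
      ; compat = λ {a} {b} {c} {a₁} {b₁} {c₁} → compat* {a} {b} {c} {a₁} {b₁} {c₁}
      ; liftʳ = λ {a} {b} → liftʳ* {a} {b}
      ; liftˡ = λ {a} {b} → liftˡ* {a} {b}
      }

  module Necessity (CU : IsCongruence USum (ext _∼_)) where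
    module D = IsCongruence CU

    η-compatˡ : ∀ {a b c a₁ b₁ c₁} → Sum (γ b) c a → Sum (γ b₁) c₁ a₁ →
                a ∼ a₁ → b ∼ b₁ → c ∼ c₁
    η-compatˡ {a} {b} {c} {a₁} {b₁} {c₁} s s₁ =
      D.compat {η a} {inj₁ b} {η c} {η a₁} {inj₁ b₁} {η c₁} (ηsumˡ s) (ηsumˡ s₁)

    η-compatʳ : ∀ {a b d a₁ b₁ d₁} → Sum d a b → Sum d₁ a₁ b₁ →
                a ∼ a₁ → b ∼ b₁ → d ∼ d₁
    η-compatʳ {a} {b} {d} {a₁} {b₁} {d₁} s s₁ =
      D.compat {inj₁ a} {η b} {η d} {inj₁ a₁} {η b₁} {η d₁} (ηsumʳ s) (ηsumʳ s₁)

    -- (C3) of U on ηa + b = ηc, replacing ηa by ηa₁; the lift must again be such a sum.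
    η-liftʳ : ∀ {a b c a₁} → Sum (γ b) c a → a₁ ∼ a →
              ∃₂ λ b₁ c₁ → b₁ ∼ b × Sum (γ b₁) c₁ a₁
    η-liftʳ {a} {b} {c} {a₁} s p with D.liftʳ {η a} {inj₁ b} (η c , ηsumˡ s) (η a₁) p
    ... | inj₁ b₁ , q , (inj₂ c₁ , (_ , s₁)) = b₁ , c₁ , q , s₁

    η-liftˡ : ∀ {a b c b₂} → Sum (γ b) c a → b₂ ∼ b →
              ∃₂ λ a₂ c₂ → a₂ ∼ a × Sum (γ b₂) c₂ a₂
    η-liftˡ {a} {b} {c} {b₂} s p with D.liftˡ {η a} {inj₁ b} (η c , ηsumˡ s) (inj₁ b₂) p
    ... | inj₂ a₂ , q , (inj₂ c₂ , (_ , s₂)) = a₂ , c₂ , q , s₂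

    -- The unit decomposes as ηγa + a = 1, witnessed by γa ⊕ 0 = γa.
    -- Lift ηγa + a = 1 along b ∼ a to ηx + b = ηc; then c ∼ 0 and x = γb ⊕ c ∼ γb.
    γ-preserves : ∀ {a b} → a ∼ b → γ a ∼ γ b
    γ-preserves {a} p with η-liftˡ (neutralʳ (γ a)) (E.sym p)
    ... | x , c , x∼γa , s =
      E.trans (E.sym x∼γa) (E.sym (∼𝟘-summand P CP s (E.sym 𝟘∼c)))
      where
      𝟘∼c : 𝟘 ∼ c
      𝟘∼c = η-compatˡ (neutralʳ (γ a)) s (E.sym x∼γa) p

    -- Lift ηc + γ⁻¹c = 1 along 0 ∼ c to η0 + b₁ = ηc₁; then γb₁ ≤ 0, so b₁ = 0.
    γ⁻¹-preserves-𝟘 : ∀ {c} → c ∼ 𝟘 → γ⁻¹ c ∼ 𝟘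
    γ⁻¹-preserves-𝟘 {c} p with η-liftʳ (γγ⁻¹-sum (neutralʳ c)) (E.sym p)
    ... | b₁ , _ , b₁∼γ⁻¹c , s = subst (γ⁻¹ c ∼_) (γ-below-𝟘 s) (E.sym b₁∼γ⁻¹c)

    -- Lift ηγa + a = 1 along γb ∼ γa to ηγb + y = ηc; then c ∼ 0 and b = y ⊕ γ⁻¹c ∼ y ∼ a.
    γ-reflects : ∀ {a b} → γ a ∼ γ b → a ∼ b
    γ-reflects {a} p with η-liftʳ (neutralʳ (γ a)) (E.sym p)
    ... | y , c , y∼a , s =
      E.trans (E.sym y∼a) (∼𝟘-summand P CP (γ⁻¹-sum s) (γ⁻¹-preserves-𝟘 (E.sym 𝟘∼c)))
      where
      𝟘∼c : 𝟘 ∼ c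
      𝟘∼c = η-compatˡ (neutralʳ (γ a)) s p (E.sym y∼a)

    γ-congruence : IsγCongruence γ _∼_
    γ-congruence a b = mk⇔ γ-preserves γ-reflects

    -- Left cancellation via ηx + γ⁻¹a = ηa₁, right cancellation via a + ηx = ηa₁.
    c4 : C4 Sum _∼_
    c4 = (λ p s s₁ q → η-compatˡ (γγ⁻¹-sum s) (γγ⁻¹-sum s₁) q (γ⁻¹-preserves (λ {x} {y} → γ-reflects {x} {y}) p))
       , (λ p s s₁ q → η-compatʳ s s₁ p q)

    -- Lift ηbc + γ⁻¹b = ηc along a ∼ bc to ηa + b₁ = ηe, i.e. a = γb₁ ⊕ e.
    c5 : C5′ Sum _∼_
    c5 {a} {b} s p with η-liftʳ (γγ⁻¹-sum s) p
    ... | b₁ , e , b₁∼γ⁻¹b , s₁ =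
      γ b₁ , e , s₁ , subst (γ b₁ ∼_) (γ-γ⁻¹ b) (γ-preserves b₁∼γ⁻¹b) ,
      E.sym (η-compatˡ (γγ⁻¹-sum s) s₁ (E.sym p) (E.sym b₁∼γ⁻¹b))

theorem4p17 : (P : GPEA) (G : UnitizingAut P) (_∼_ : Rel (GPEA.Carrier P) 0ℓ) →
    IsCongruence (GPEA.Sum P) _∼_ →
    IsCongruence (Unitization.USum P G) (Unitization.ext P G _∼_)
      ⇔ (IsγCongruence (UnitizingAut.γ G) _∼_ × C4 (GPEA.Sum P) _∼_ × C5′ (GPEA.Sum P) _∼_)
theorem4p17 P G _∼_ CP = mk⇔ necessary sufficient
  where
  open GPEA P using (Sum)
  open UnitizingAut G using (γ)
  open Unitization P G using (USum; ext)

  necessary : IsCongruence USum (ext _∼_) → IsγCongruence γ _∼_ × C4 Sum _∼_ × C5′ Sum _∼_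
  necessary CU = γ-congruence , c4 , c5
    where open Necessity P G _∼_ CP CU

  sufficient : IsγCongruence γ _∼_ × C4 Sum _∼_ × C5′ Sum _∼_ → IsCongruence USum (ext _∼_)
  sufficient (γc , c4 , c5) = Sufficiency.isCongruence* P G _∼_ CP γc c4 c5
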